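{- If $w$ is a square-free walk in the digraph $\hat D$, then the set $\delta(w)$ is square-free.
   Context: Let $\Gamma=\{\mathtt{a},\mathtt{b},\mathtt{c}\}$ and let $\mathbb{S}_\Gamma$ be the six permutations of $\Gamma$ in cycle notation: $()$ (identity), $(\mathtt{ab})$, $(\mathtt{ac})$, $(\mathtt{bc})$, $(\mathtt{abc})$ (mapping $\mathtt{a}\mapsto\mathtt{b}\mapsto\mathtt{c}\mapsto\mathtt{a}$), $(\mathtt{acb})$. For each $\pi$ let $\tilde\pi$ be a new symbol (its mirror image), $\widetilde{\mathbb{S}}_\Gamma=\{\tilde\pi\}$. The digraph $D$ has vertex set $V(D)=\mathbb{S}_\Gamma\cup\widetilde{\mathbb{S}}_\Gamma$ and exactly the 24 arcs: $()\to\widetilde{(\mathtt{ab})}$, $()\to(\mathtt{bc})$; $(\mathtt{ab})\to\widetilde{()}$, $(\mathtt{ab})\to(\mathtt{abc})$; $(\mathtt{ac})\to\widetilde{(\mathtt{abc})}$, $(\mathtt{ac})\to(\mathtt{acb})$; $(\mathtt{bc})\to\widetilde{(\mathtt{acb})}$, $(\mathtt{bc})\to()$; $(\mathtt{abc})\to\widetilde{(\mathtt{ac})}$, $(\mathtt{abc})\to(\mathtt{ab})$; $(\mathtt{acb})\to\widetilde{(\mathtt{bc})}$, $(\mathtt{acb})\to(\mathtt{ac})$; $\widetilde{()}\to(\mathtt{ac})$, $\widetilde{()}\to\widetilde{(\mathtt{bc})}$; $\widetilde{(\mathtt{ab})}\to(\mathtt{acb})$, $\widetilde{(\mathtt{ab})}\to\widetilde{(\mathtt{abc})}$;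 $\widetilde{(\mathtt{ac})}\to()$, $\widetilde{(\mathtt{ac})}\to\widetilde{(\mathtt{acb})}$; $\widetilde{(\mathtt{bc})}\to(\mathtt{abc})$, $\widetilde{(\mathtt{bc})}\to\widetilde{()}$; $\widetilde{(\mathtt{abc})}\to(\mathtt{bc})$, $\widetilde{(\mathtt{abc})}\to\widetilde{(\mathtt{ab})}$; $\widetilde{(\mathtt{acb})}\to(\mathtt{ab})$, $\widetilde{(\mathtt{acb})}\to\widetilde{(\mathtt{ac})}$. The digraph $\hat D$ is obtained from $D$ by adding, for every $x\in V(D)$, two new vertices $p_x,s_x$ and arcs $p_x\to x$ and $x\to s_x$. A walk is treated as the word of its successive vertices (consecutive vertices joined by an arc); it is square-free if that word has no factor $yy$ with $y$ nonempty. For a word $N$ over $\Gamma$ and $\pi\in\mathbb{S}_\Gamma$, $N_\pi$ is obtained by applying $\pi$ letterwise, and $N_{\tilde\pi}$ is the reversal of $N_\pi$. Let $P=\mathtt{abacbcabcbacabacbcabcbabcacbcabcbacabacbcabcbacbc}$, $Q=\mathtt{abacbabcacbacabacbcacbacabcbabcabacbcabcb}$, $R=\mathtt{abacabcacbacabcbabcacbacabacbcacbacabcbabcabacbcabcb}$, $S=\mathtt{acabacbabcacbacabcbacbcabacbabcacbacabcbabcacbaca}$. The substitution $\delta:V(\hat D)^*\to 2^{\Gamma^*}$ is given on letters by $\delta(x)=\{Q_x,R_x\}$ for $x\in V(D)$; $\delta(p_x)=\{P_x\}$, $\delta(s_x)=\{S_x\}$ for $x\in\mathbb{S}_\Gamma$;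 $\delta(p_x)=\{S_x\}$, $\delta(s_x)=\{P_x\}$ for $x\in\widetilde{\mathbb{S}}_\Gamma$; and on words by $\delta(a_1\cdots a_n)=\{A_1\cdots A_n: A_i\in\delta(a_i)\}$. A set of words is square-free if each of its words is. -}

module Defs where

open import Data.List using (List; []; _∷_; _++_; map; reverse; concatMap)
open import Data.Product using (∃-syntax; _×_)
open import Relation.Nullary using (¬_)
open import Relation.Binary.PropositionalEquality using (_≡_; _≢_)

data Γ : Set where
  a b c : Γ

-- The six permutations of Γ (cycle notation)
data Perm : Set where
  id ab ac bc abc acb : Perm

apply : Perm → Γ → Γ
apply id  x = x
apply ab  a = b
apply ab  b = a
apply ab  c = c
apply ac  a = c
apply ac  b = b
apply ac  c = a
apply bc  a = a
apply bc  b = c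
apply bc  c = b
apply abc a = b
apply abc b = c
apply abc c = a
apply acb a = c
apply acb b = a
apply acb c = b

-- Vertices of D : S_Γ ∪ S̃_Γ
data DV : Set where
  orig : Perm → DV
  mirr : Perm → DV

data DArc : DV → DV → Set where
  a01 : DArc (orig id)  (mirr ab)
  a02 : DArc (orig id)  (orig bc)
  a03 : DArc (orig ab)  (mirr id)
  a04 : DArc (orig ab)  (orig abc)
  a05 : DArc (orig ac)  (mirr abc)
  a06 : DArc (orig ac)  (orig acb)
  a07 : DArc (orig bc)  (mirr acb)
  a08 : DArc (orig bc)  (orig id)
  a09 : DArc (orig abc) (mirr ac)
  a10 : DArc (orig abc) (orig ab)
  a11 : DArc (orig acb) (mirr bc)
  a12 : DArc (orig acb) (orig ac)
  a13 : DArc (mirr id)  (orig ac)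
  a14 : DArc (mirr id)  (mirr bc)
  a15 : DArc (mirr ab)  (orig acb)
  a16 : DArc (mirr ab)  (mirr abc)
  a17 : DArc (mirr ac)  (orig id)
  a18 : DArc (mirr ac)  (mirr acb)
  a19 : DArc (mirr bc)  (orig abc)
  a20 : DArc (mirr bc)  (mirr id)
  a21 : DArc (mirr abc) (orig bc)
  a22 : DArc (mirr abc) (mirr ab)
  a23 : DArc (mirr acb) (orig ab)
  a24 : DArc (mirr acb) (mirr ac)

data V̂ : Set where
  v : DV → V̂
  p : DV → V̂
  s : DV → V̂

data Arĉ : V̂ → V̂ → Set where
  old : ∀ {x y} → DArc x y → Arĉ (v x) (v y)
  pre : ∀ {x} → Arĉ (p x) (v x)
  suf : ∀ {x} → Arĉ (v x) (s x)

data IsWalk : List V̂ → Set where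
  nil  : IsWalk []
  one  : ∀ x → IsWalk (x ∷ [])
  cons : ∀ {x y w} → Arĉ x y → IsWalk (y ∷ w) → IsWalk (x ∷ y ∷ w)

SquareFree : {A : Set} → List A → Set
SquareFree {A} w =
  ¬ (∃[ x ] ∃[ y ] ∃[ z ] (y ≢ [] × w ≡ x ++ (y ++ (y ++ z))))

act : DV → List Γ → List Γ
act (orig π) N = map (apply π) N
act (mirr π) N = reverse (map (apply π) N)

wordP : List Γ
wordP = a ∷ b ∷ a ∷ c ∷ b ∷ c ∷ a ∷ b ∷ c ∷ b ∷ a ∷ c ∷ a ∷ b ∷ a ∷ c ∷ b ∷ c ∷ a ∷ b ∷ c ∷ b ∷ a ∷ b ∷ c ∷ a ∷ c ∷ b ∷ c ∷ a ∷ b ∷ c ∷ b ∷ a ∷ c ∷ a ∷ b ∷ a ∷ c ∷ b ∷ c ∷ a ∷ b ∷ c ∷ b ∷ a ∷ c ∷ b ∷ c ∷ []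

wordQ : List Γ
wordQ = a ∷ b ∷ a ∷ c ∷ b ∷ a ∷ b ∷ c ∷ a ∷ c ∷ b ∷ a ∷ c ∷ a ∷ b ∷ a ∷ c ∷ b ∷ c ∷ a ∷ c ∷ b ∷ a ∷ c ∷ a ∷ b ∷ c ∷ b ∷ a ∷ b ∷ c ∷ a ∷ b ∷ a ∷ c ∷ b ∷ c ∷ a ∷ b ∷ c ∷ b ∷ []

wordR : List Γ
wordR = a ∷ b ∷ a ∷ c ∷ a ∷ b ∷ c ∷ a ∷ c ∷ b ∷ a ∷ c ∷ a ∷ b ∷ c ∷ b ∷ a ∷ b ∷ c ∷ a ∷ c ∷ b ∷ a ∷ c ∷ a ∷ b ∷ a ∷ c ∷ b ∷ c ∷ a ∷ c ∷ b ∷ a ∷ c ∷ a ∷ b ∷ c ∷ b ∷ a ∷ b ∷ c ∷ a ∷ b ∷ a ∷ c ∷ b ∷ c ∷ a ∷ b ∷ c ∷ b ∷ []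

wordS : List Γ
wordS = a ∷ c ∷ a ∷ b ∷ a ∷ c ∷ b ∷ a ∷ b ∷ c ∷ a ∷ c ∷ b ∷ a ∷ c ∷ a ∷ b ∷ c ∷ b ∷ a ∷ c ∷ b ∷ c ∷ a ∷ b ∷ a ∷ c ∷ b ∷ a ∷ b ∷ c ∷ a ∷ c ∷ b ∷ a ∷ c ∷ a ∷ b ∷ c ∷ b ∷ a ∷ b ∷ c ∷ a ∷ c ∷ b ∷ a ∷ c ∷ a ∷ []

-- δ on letters (as a finite list enumerating the set)
δ₁ : V̂ → List (List Γ)
δ₁ (v x)        = act x wordQ ∷ act x wordR ∷ []
δ₁ (p (orig π)) = act (orig π) wordP ∷ []
δ₁ (s (orig π)) = act (orig π) wordS ∷ []
δ₁ (p (mirr π)) = act (mirr π) wordS ∷ []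
δ₁ (s (mirr π)) = act (mirr π) wordP ∷ []

δ : List V̂ → List (List Γ)
δ []      = [] ∷ []
δ (x ∷ w) = concatMap (λ A → map (A ++_) (δ w)) (δ₁ x)

-- Every word of δ(w) is a concatenation of blocks, one for each vertex of w.  The blocks are at
-- least 41 letters long, they form a prefix code, and blocks of distinct vertices agree in at most
-- 20 letters at either end; these facts, and two facts about "windows" (a nonempty suffix of a
-- block followed by the blocks of the next few vertices of a walk), are checked by evaluation.
-- A square y y with |y| ≤ 46 lies in a window of depth 3, and no such window begins with a short
-- square.  If |y| ≥ 47, the first 47 letters of y determine the suffix ρ of the block in which y
-- starts, so both copies of y begin with the same block suffix ρ.  Unique decipherability then
-- makes the blocks between the two starts repeat: the walk contains x M x′ M.  If x = x′ this
-- is a square of the walk.  Otherwise ρ is a common suffix of the blocks of x and x′, so |ρ| ≤ 20,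
-- and comparing the block of x′ with the block of the vertex x″ after the second M either exhibits
-- the square (M x′) (M x″) in the walk or shows that the block of x′ has fewer than 41 letters.

module Submission where

open import Defs

open import Data.Bool using (Bool; true; false; _∧_; _∨_)
open import Data.Bool.ListAction using (all)
open import Data.Bool.Properties using (T-≡; ∨-zeroʳ) renaming (_≟_ to _≟Bool_)
open import Data.Empty using (⊥; ⊥-elim)
open import Data.List.Base
  using (List; []; _∷_; _++_; [_]; map; concatMap; cartesianProduct; foldr; length; reverse; take; drop)
open import Data.List.Properties
  using (∷-injective; ++-assoc; ++-identityʳ; ++-identityˡ-unique; ++-cancelˡ; ++-conicalˡ; ++-conicalʳ;
         map-++; concatMap-++; take++drop≡id; length-++; length-++-≤ˡ; length-take; length-reverse; reverse-++)
import Data.List.Properties as List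
open import Data.List.Membership.Propositional using (_∈_; lose; find)
open import Data.List.Membership.Propositional.Properties
  using (∈-map⁺; ∈-map⁻; ∈-++⁺ˡ; ∈-++⁺ʳ; ∈-concatMap⁺; ∈-concatMap⁻; ∈-cartesianProduct⁺)
open import Data.List.Relation.Unary.Any using (here; there)
open import Data.List.Relation.Unary.All using (All; []; _∷_)
import Data.List.Relation.Unary.All as All
open import Data.List.Relation.Unary.All.Properties using (all⁺; take⁺; ++⁻ˡ; ++⁻ʳ)
open import Data.Maybe using (Maybe; just; nothing)
open import Data.Maybe.Properties using (just-injective)
import Data.Maybe.Properties as Maybe
open import Data.Nat using (ℕ; zero; suc; _+_; _*_; _≤_; _<_; z≤n; s≤s; _≤?_)
import Data.Nat as ℕ
open import Data.Nat.Properties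
  using (≤-trans; ≤-reflexive; <⇒≱; ≮⇒≥; ≰⇒>; +-mono-≤; +-monoʳ-≤; +-suc; +-identityʳ; m≤m+n; m≤n+m;
         m≤n⇒m⊓n≡m; m≤n⇒m<n∨m≡n)
open import Data.Product using (_×_; _,_; proj₁; proj₂; ∃-syntax)
import Data.Product.Properties as Product
open import Data.Sum using (_⊎_; inj₁; inj₂)
open import Function using (_∘_)
open import Function.Bundles using (Equivalence)
open import Level using (0ℓ)
open import Relation.Binary.Definitions using (DecidableEquality)
open import Relation.Binary.PropositionalEquality
  using (_≡_; _≢_; refl; sym; trans; cong; subst; module ≡-Reasoning)
open import Relation.Nullary using (¬_)
open import Relation.Nullary.Decidable using (Dec; yes; no; isYes; map′; ¬?; _→-dec_; _×-dec_)
open import Relation.Unary using (Pred; Decidable)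

-- Lists

module _ {A : Set} where

  ++-≡-++ : ∀ (as bs cs ds : List A) → as ++ bs ≡ cs ++ ds →
            (∃[ m ] cs ≡ as ++ m × bs ≡ m ++ ds) ⊎ (∃[ m ] m ≢ [] × as ≡ cs ++ m × ds ≡ m ++ bs)
  ++-≡-++ []       bs cs       ds eq = inj₁ (cs , refl , eq)
  ++-≡-++ (x ∷ as) bs []       ds eq = inj₂ (x ∷ as , (λ ()) , refl , sym eq)
  ++-≡-++ (x ∷ as) bs (y ∷ cs) ds eq with refl , eq′ ← ∷-injective eq with ++-≡-++ as bs cs ds eq′
  ... | inj₁ (m , e₁ , e₂)        = inj₁ (m , cong (x ∷_) e₁ , e₂)
  ... | inj₂ (m , m≢[] , e₁ , e₂) = inj₂ (m , m≢[] , cong (x ∷_) e₁ , e₂)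

  length-++-< : ∀ (as : List A) {bs} → bs ≢ [] → length as < length (as ++ bs)
  length-++-< []       {[]}    bs≢[] = ⊥-elim (bs≢[] refl)
  length-++-< []       {_ ∷ _} _     = s≤s z≤n
  length-++-< (_ ∷ as) bs≢[]         = s≤s (length-++-< as bs≢[])

  ++-≡-++-≤ : ∀ (as bs cs ds : List A) → as ++ bs ≡ cs ++ ds → length cs ≤ length as →
              ∃[ m ] as ≡ cs ++ m
  ++-≡-++-≤ as bs cs ds eq cs≤as with ++-≡-++ as bs cs ds eq
  ... | inj₂ (m , _ , as≡ , _)  = m , as≡
  ... | inj₁ ([] , cs≡ , _)     = [] , trans (sym (++-identityʳ as)) (trans (sym cs≡) (sym (++-identityʳ cs)))
  ... | inj₁ (_ ∷ _ , refl , _) = ⊥-elim (<⇒≱ (length-++-< as (λ ())) cs≤as)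

  take-length-++ : ∀ (as bs : List A) → take (length as) (as ++ bs) ≡ as
  take-length-++ []       bs = refl
  take-length-++ (x ∷ as) bs = cong (x ∷_) (take-length-++ as bs)

  drop-length-++ : ∀ (as bs : List A) → drop (length as) (as ++ bs) ≡ bs
  drop-length-++ []       bs = refl
  drop-length-++ (x ∷ as) bs = drop-length-++ as bs

  take-++ : ∀ {n} (as bs : List A) → n ≤ length as → take n (as ++ bs) ≡ take n as
  take-++ {zero}  _        _  _          = refl
  take-++ {suc n} (x ∷ as) bs (s≤s n≤as) = cong (x ∷_) (take-++ as bs n≤as)

  drop-suc : ∀ n (as : List A) → drop 1 (drop n as) ≡ drop (suc n) as
  drop-suc zero    as       = refl
  drop-suc (suc n) []       = refl
  drop-suc (suc n) (_ ∷ as) = drop-suc n as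

  common-prefix-≤ : ∀ n (α : List A) {P Q β β′} → take (suc n) P ≢ take (suc n) Q →
                    P ≡ α ++ β → Q ≡ α ++ β′ → length α ≤ n
  common-prefix-≤ n α {β = β} {β′} differ refl refl =
    ≮⇒≥ (λ n<α → differ (trans (take-++ α β n<α) (sym (take-++ α β′ n<α))))

  ++-second-half : ∀ (α ρ M α′ y Z W : List A) → α ++ y ≡ ((α ++ ρ) ++ M) ++ α′ → y ++ Z ≡ ρ ++ W →
                   W ≡ M ++ α′ ++ Z
  ++-second-half α ρ M α′ y Z W e₁ e₂ = ++-cancelˡ ρ _ _ (begin
    ρ ++ W              ≡⟨ sym e₂ ⟩
    y ++ Z              ≡⟨ cong (_++ Z) y≡ ⟩
    (ρ ++ M ++ α′) ++ Z ≡⟨ ++-assoc ρ (M ++ α′) Z ⟩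
    ρ ++ (M ++ α′) ++ Z ≡⟨ cong (ρ ++_) (++-assoc M α′ Z) ⟩
    ρ ++ M ++ α′ ++ Z   ∎)
    where
      open ≡-Reasoning
      y≡ : y ≡ ρ ++ M ++ α′
      y≡ = ++-cancelˡ α _ _ (begin
        α ++ y                  ≡⟨ e₁ ⟩
        ((α ++ ρ) ++ M) ++ α′   ≡⟨ ++-assoc (α ++ ρ) M α′ ⟩
        (α ++ ρ) ++ M ++ α′     ≡⟨ ++-assoc α ρ (M ++ α′) ⟩
        α ++ ρ ++ M ++ α′       ∎)

  SquareFree-++⁻ʳ : ∀ (as : List A) {bs} → SquareFree (as ++ bs) → SquareFree bs
  SquareFree-++⁻ʳ as sf (x , y , z , y≢[] , refl) = sf (as ++ x , y , z , y≢[] , sym (++-assoc as x _))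

  ¬SquareFree-x∷M-twice : ∀ {x x′ : A} M R → x ≡ x′ → ¬ SquareFree (x ∷ M ++ x′ ∷ M ++ R)
  ¬SquareFree-x∷M-twice M R refl sf = sf ([] , _ ∷ M , R , (λ ()) , refl)

  ¬SquareFree-M∷ʳx-twice : ∀ {x x′ : A} w M R → x ≡ x′ → ¬ SquareFree (w ∷ M ++ x ∷ M ++ x′ ∷ R)
  ¬SquareFree-M∷ʳx-twice {x} w M R refl sf =
    sf ([ w ] , M ++ [ x ] , R , (λ eq → [x]≢[] (++-conicalʳ M [ x ] eq)) , cong (w ∷_) (sym reassociate))
    where
      [x]≢[] : [ x ] ≢ []
      [x]≢[] ()
      reassociate : (M ++ [ x ]) ++ (M ++ [ x ]) ++ R ≡ M ++ x ∷ M ++ x ∷ R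
      reassociate = trans (++-assoc M [ x ] _) (cong (λ Y → M ++ x ∷ Y) (++-assoc M [ x ] R))

-- Vertices, arcs and walks of D̂

_≟Γ_ : DecidableEquality Γ
a ≟Γ a = yes refl
a ≟Γ b = no λ ()
a ≟Γ c = no λ ()
b ≟Γ a = no λ ()
b ≟Γ b = yes refl
b ≟Γ c = no λ ()
c ≟Γ a = no λ ()
c ≟Γ b = no λ ()
c ≟Γ c = yes refl

perm-index : Perm → ℕ
perm-index id  = 0
perm-index ab  = 1
perm-index ac  = 2
perm-index bc  = 3
perm-index abc = 4
perm-index acb = 5

perm-at : ℕ → Perm
perm-at 1 = ab
perm-at 2 = ac
perm-at 3 = bc
perm-at 4 = abc
perm-at 5 = acb
perm-at _ = id

perm-at-index : ∀ π → perm-at (perm-index π) ≡ π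
perm-at-index id  = refl
perm-at-index ab  = refl
perm-at-index ac  = refl
perm-at-index bc  = refl
perm-at-index abc = refl
perm-at-index acb = refl

perm-index-injective : ∀ π σ → perm-index π ≡ perm-index σ → π ≡ σ
perm-index-injective π σ eq = trans (sym (perm-at-index π)) (trans (cong perm-at eq) (perm-at-index σ))

_≟Perm_ : DecidableEquality Perm
π ≟Perm σ = map′ (perm-index-injective π σ) (cong perm-index) (perm-index π ℕ.≟ perm-index σ)

_≟DV_ : DecidableEquality DV
orig π ≟DV orig σ = map′ (cong orig) (λ { refl → refl }) (π ≟Perm σ)
orig π ≟DV mirr σ = no λ ()
mirr π ≟DV orig σ = no λ ()
mirr π ≟DV mirr σ = map′ (cong mirr) (λ { refl → refl }) (π ≟Perm σ)

_≟V̂_ : DecidableEquality V̂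
v x ≟V̂ v y = map′ (cong v) (λ { refl → refl }) (x ≟DV y)
v x ≟V̂ p y = no λ ()
v x ≟V̂ s y = no λ ()
p x ≟V̂ v y = no λ ()
p x ≟V̂ p y = map′ (cong p) (λ { refl → refl }) (x ≟DV y)
p x ≟V̂ s y = no λ ()
s x ≟V̂ v y = no λ ()
s x ≟V̂ p y = no λ ()
s x ≟V̂ s y = map′ (cong s) (λ { refl → refl }) (x ≟DV y)

perms : List Perm
perms = id ∷ ab ∷ ac ∷ bc ∷ abc ∷ acb ∷ []

∈-perms : ∀ π → π ∈ perms
∈-perms id  = here refl
∈-perms ab  = there (here refl)
∈-perms ac  = there (there (here refl))
∈-perms bc  = there (there (there (here refl)))
∈-perms abc = there (there (there (there (here refl))))
∈-perms acb = there (there (there (there (there (here refl)))))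

verticesD : List DV
verticesD = map orig perms ++ map mirr perms

∈-verticesD : ∀ x → x ∈ verticesD
∈-verticesD (orig π) = ∈-++⁺ˡ (∈-map⁺ orig (∈-perms π))
∈-verticesD (mirr π) = ∈-++⁺ʳ (map orig perms) (∈-map⁺ mirr (∈-perms π))

vertices : List V̂
vertices = map v verticesD ++ map p verticesD ++ map s verticesD

∈-vertices : ∀ x → x ∈ vertices
∈-vertices (v x) = ∈-++⁺ˡ (∈-map⁺ v (∈-verticesD x))
∈-vertices (p x) = ∈-++⁺ʳ (map v verticesD) (∈-++⁺ˡ (∈-map⁺ p (∈-verticesD x)))
∈-vertices (s x) = ∈-++⁺ʳ (map v verticesD) (∈-++⁺ʳ (map p verticesD) (∈-map⁺ s (∈-verticesD x)))

successorsD : DV → List DV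
successorsD (orig id)  = mirr ab  ∷ orig bc  ∷ []
successorsD (orig ab)  = mirr id  ∷ orig abc ∷ []
successorsD (orig ac)  = mirr abc ∷ orig acb ∷ []
successorsD (orig bc)  = mirr acb ∷ orig id  ∷ []
successorsD (orig abc) = mirr ac  ∷ orig ab  ∷ []
successorsD (orig acb) = mirr bc  ∷ orig ac  ∷ []
successorsD (mirr id)  = orig ac  ∷ mirr bc  ∷ []
successorsD (mirr ab)  = orig acb ∷ mirr abc ∷ []
successorsD (mirr ac)  = orig id  ∷ mirr acb ∷ []
successorsD (mirr bc)  = orig abc ∷ mirr id  ∷ []
successorsD (mirr abc) = orig bc  ∷ mirr ab  ∷ []
successorsD (mirr acb) = orig ab  ∷ mirr ac  ∷ []

DArc⇒∈successorsD : ∀ {x y} → DArc x y → y ∈ successorsD x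
DArc⇒∈successorsD a01 = here refl
DArc⇒∈successorsD a02 = there (here refl)
DArc⇒∈successorsD a03 = here refl
DArc⇒∈successorsD a04 = there (here refl)
DArc⇒∈successorsD a05 = here refl
DArc⇒∈successorsD a06 = there (here refl)
DArc⇒∈successorsD a07 = here refl
DArc⇒∈successorsD a08 = there (here refl)
DArc⇒∈successorsD a09 = here refl
DArc⇒∈successorsD a10 = there (here refl)
DArc⇒∈successorsD a11 = here refl
DArc⇒∈successorsD a12 = there (here refl)
DArc⇒∈successorsD a13 = here refl
DArc⇒∈successorsD a14 = there (here refl)
DArc⇒∈successorsD a15 = here refl
DArc⇒∈successorsD a16 = there (here refl)
DArc⇒∈successorsD a17 = here refl
DArc⇒∈successorsD a18 = there (here refl)
DArc⇒∈successorsD a19 = here refl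
DArc⇒∈successorsD a20 = there (here refl)
DArc⇒∈successorsD a21 = here refl
DArc⇒∈successorsD a22 = there (here refl)
DArc⇒∈successorsD a23 = here refl
DArc⇒∈successorsD a24 = there (here refl)

successors : V̂ → List V̂
successors (v x) = map v (successorsD x) ++ [ s x ]
successors (p x) = [ v x ]
successors (s x) = []

Arĉ⇒∈successors : ∀ {x y} → Arĉ x y → y ∈ successors x
Arĉ⇒∈successors (old e)   = ∈-++⁺ˡ (∈-map⁺ v (DArc⇒∈successorsD e))
Arĉ⇒∈successors pre       = here refl
Arĉ⇒∈successors (suf {x}) = ∈-++⁺ʳ (map v (successorsD x)) (here refl)

IsWalk-tail : ∀ {x xs} → IsWalk (x ∷ xs) → IsWalk xs
IsWalk-tail (one _)    = nil
IsWalk-tail (cons _ w) = w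

IsWalk-++⁻ʳ : ∀ xs {ys} → IsWalk (xs ++ ys) → IsWalk ys
IsWalk-++⁻ʳ []       w = w
IsWalk-++⁻ʳ (x ∷ xs) w = IsWalk-++⁻ʳ xs (IsWalk-tail w)

-- Walks of at most k steps leaving x, with x itself omitted.
walksFrom : ℕ → V̂ → List (List V̂)
walksFrom zero    x = [ [] ]
walksFrom (suc k) x = [] ∷ concatMap (λ y → map (y ∷_) (walksFrom k y)) (successors x)

-- Blocks

Token : Set
Token = V̂ × List Γ

vertex : Token → V̂
vertex = proj₁

block : Token → List Γ
block = proj₂

data IsToken : Pred Token 0ℓ where
  isToken : ∀ {x A} → A ∈ δ₁ x → IsToken (x , A)

_≟Token_ : DecidableEquality Token
_≟Token_ = Product.≡-dec _≟V̂_ (List.≡-dec _≟Γ_)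

tokens : List Token
tokens = concatMap (λ x → map (x ,_) (δ₁ x)) vertices

IsToken⇒∈tokens : ∀ {t} → IsToken t → t ∈ tokens
IsToken⇒∈tokens (isToken {x} A∈δ₁x) =
  ∈-concatMap⁺ (λ x → map (x ,_) (δ₁ x)) (lose (∈-vertices x) (∈-map⁺ (x ,_) A∈δ₁x))

path : List Token → List V̂
path = map vertex

word : List Token → List Γ
word = concatMap block

δ-factorisation : ∀ w {u} → u ∈ δ w → ∃[ ts ] All IsToken ts × path ts ≡ w × word ts ≡ u
δ-factorisation []      (here refl) = [] , [] , refl , refl
δ-factorisation (x ∷ w) u∈δ
  with A , A∈δ₁x , u∈ ← find (∈-concatMap⁻ (λ A → map (A ++_) (δ w)) u∈δ)
  with u′ , u′∈δw , refl ← ∈-map⁻ (A ++_) u∈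
  with ts , valid , refl , refl ← δ-factorisation w u′∈δw
  = (x , A) ∷ ts , isToken A∈δ₁x ∷ valid , refl , refl

word-∈-δ : ∀ {ts} → All IsToken ts → word ts ∈ δ (path ts)
word-∈-δ []                             = here refl
word-∈-δ {(x , A) ∷ ts} (isToken A∈δ₁x ∷ valid) =
  ∈-concatMap⁺ (λ A → map (A ++_) (δ (path ts))) (lose A∈δ₁x (∈-map⁺ (A ++_) (word-∈-δ valid)))

continuations : ℕ → V̂ → List (List Γ)
continuations k x = concatMap δ (walksFrom k x)

path-take-∈-walksFrom : ∀ k {x ts} → IsWalk (x ∷ path ts) → path (take k ts) ∈ walksFrom k x
path-take-∈-walksFrom zero    _               = here refl
path-take-∈-walksFrom (suc k) {ts = []}    _  = here refl
path-take-∈-walksFrom (suc k) {ts = t ∷ ts} (cons arc walk) =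
  there (∈-concatMap⁺ (λ y → map (y ∷_) (walksFrom k y))
    (lose (Arĉ⇒∈successors arc) (∈-map⁺ (vertex t ∷_) (path-take-∈-walksFrom k walk))))

word-take-∈-continuations : ∀ k {x ts} → All IsToken ts → IsWalk (x ∷ path ts) →
                            word (take k ts) ∈ continuations k x
word-take-∈-continuations k valid walk =
  ∈-concatMap⁺ δ (lose (path-take-∈-walksFrom k walk) (word-∈-δ (take⁺ k valid)))

-- Finite checks

-- Deciding the larger statements below with `all?` exhausts memory; evaluating a Boolean test and
-- extracting the evidence afterwards does not.
record Checked {A : Set} {P : A → Set} (P? : Decidable P) (xs : List A) : Set where
  constructor evaluated
  field evaluates-to-true : all (isYes ∘ P?) xs ≡ true

checked : ∀ {A : Set} {P : A → Set} {P? : Decidable P} {xs} → Checked P? xs → ∀ {x} → x ∈ xs → P x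
checked {P? = P?} {xs} (evaluated h) {x} x∈xs =
  witness (P? x) (Equivalence.to T-≡ (All.lookup (all⁺ (isYes ∘ P?) xs (Equivalence.from T-≡ h)) x∈xs))
  where
    witness : ∀ {Q} (Q? : Dec Q) → isYes Q? ≡ true → Q
    witness (yes q) _ = q

nonemptySuffixes : {A : Set} → List A → List (List A)
nonemptySuffixes []       = []
nonemptySuffixes (x ∷ xs) = (x ∷ xs) ∷ nonemptySuffixes xs

∈-nonemptySuffixes : ∀ {A : Set} (α : List A) {ρ} → ρ ≢ [] → ρ ∈ nonemptySuffixes (α ++ ρ)
∈-nonemptySuffixes []      {[]}    ρ≢[] = ⊥-elim (ρ≢[] refl)
∈-nonemptySuffixes []      {_ ∷ _} _    = here refl
∈-nonemptySuffixes (_ ∷ α) ρ≢[]         = there (∈-nonemptySuffixes α ρ≢[])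

windows : ℕ → List (List Γ × List Γ)
windows k = concatMap (λ t → cartesianProduct (nonemptySuffixes (block t)) (continuations k (vertex t))) tokens

∈-windows : ∀ k {t} α {ρ e} → IsToken t → block t ≡ α ++ ρ → ρ ≢ [] → e ∈ continuations k (vertex t) →
            (ρ , e) ∈ windows k
∈-windows k α t∈ refl ρ≢[] e∈ =
  ∈-concatMap⁺ (λ t → cartesianProduct (nonemptySuffixes (block t)) (continuations k (vertex t)))
    (lose (IsToken⇒∈tokens t∈) (∈-cartesianProduct⁺ (∈-nonemptySuffixes α ρ≢[]) e∈))

agree : ℕ → List Γ → List Γ → Bool
agree zero    _       _       = true
agree (suc n) (x ∷ u) (y ∷ d) = isYes (x ≟Γ y) ∧ agree n u d
agree (suc n) _       _       = false

agree-++ : ∀ y u u′ → agree (length y) (y ++ u) (y ++ u′) ≡ true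
agree-++ []      u u′ = refl
agree-++ (x ∷ y) u u′ with x ≟Γ x
... | yes _  = agree-++ y u u′
... | no x≢x = ⊥-elim (x≢x refl)

module _ (w : List Γ) where
  -- Invariant: d = drop n w; the half-lengths n, n + 1, …, n + f - 1 are tested.
  squareFrom : ℕ → ℕ → List Γ → Bool
  squareFrom zero    n d = false
  squareFrom (suc f) n d = agree n w d ∨ squareFrom f (suc n) (drop 1 d)

startsWithShortSquare : List Γ → Bool
startsWithShortSquare w = squareFrom w 46 1 (drop 1 w)

squareFrom-complete : ∀ y z f n → n ≤ length y → length y < n + f →
                      squareFrom (y ++ y ++ z) f n (drop n (y ++ y ++ z)) ≡ true
squareFrom-complete y z zero n n≤y y<n rewrite +-identityʳ n = ⊥-elim (<⇒≱ y<n n≤y)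
squareFrom-complete y z (suc f) n n≤y y<n with m≤n⇒m<n∨m≡n n≤y
... | inj₂ refl rewrite drop-length-++ y (y ++ z) | agree-++ y (y ++ z) z = refl
... | inj₁ n<y rewrite drop-suc n (y ++ y ++ z) | +-suc n f =
  trans (cong (agree n (y ++ y ++ z) (drop n (y ++ y ++ z)) ∨_) (squareFrom-complete y z f (suc n) n<y y<n))
        (∨-zeroʳ _)

startsWithShortSquare-complete : ∀ y z → y ≢ [] → length y ≤ 46 → startsWithShortSquare (y ++ y ++ z) ≡ true
startsWithShortSquare-complete []      z y≢[] _    = ⊥-elim (y≢[] refl)
startsWithShortSquare-complete (x ∷ y) z _    y≤46 = squareFrom-complete (x ∷ y) z 46 1 (s≤s z≤n) (s≤s y≤46)

data Trie (A : Set) : Set where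
  empty : Trie A
  node  : Maybe A → Trie A → Trie A → Trie A → Trie A

module _ {A : Set} where

  lookupTrie : Trie A → List Γ → Maybe A
  lookupTrie empty           _       = nothing
  lookupTrie (node m _ _ _)  []      = m
  lookupTrie (node _ t _ _)  (a ∷ k) = lookupTrie t k
  lookupTrie (node _ _ t _)  (b ∷ k) = lookupTrie t k
  lookupTrie (node _ _ _ t)  (c ∷ k) = lookupTrie t k

  insertTrie : List Γ → A → Trie A → Trie A
  insertTrie []      y empty            = node (just y) empty empty empty
  insertTrie (a ∷ k) y empty            = node nothing (insertTrie k y empty) empty empty
  insertTrie (b ∷ k) y empty            = node nothing empty (insertTrie k y empty) empty
  insertTrie (c ∷ k) y empty            = node nothing empty empty (insertTrie k y empty)
  insertTrie []      y (node _ t u w)   = node (just y) t u w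
  insertTrie (a ∷ k) y (node m t u w)   = node m (insertTrie k y t) u w
  insertTrie (b ∷ k) y (node m t u w)   = node m t (insertTrie k y u) w
  insertTrie (c ∷ k) y (node m t u w)   = node m t u (insertTrie k y w)


blocks-long-checked : Checked (λ t → 41 ≤? length (block t)) tokens
blocks-long-checked = evaluated refl

PrefixFree : Token × Token → Set
PrefixFree (t , t′) = take (length (block t)) (block t′) ≡ block t → t ≡ t′

prefixFree? : Decidable PrefixFree
prefixFree? (t , t′) = List.≡-dec _≟Γ_ (take (length (block t)) (block t′)) (block t) →-dec t ≟Token t′

prefix-free-checked : Checked prefixFree? (cartesianProduct tokens tokens)
prefix-free-checked = evaluated refl

EndsDiffer : Token × Token → Set
EndsDiffer (t , t′) = vertex t ≢ vertex t′ →
  take 21 (block t) ≢ take 21 (block t′) × take 21 (reverse (block t)) ≢ take 21 (reverse (block t′))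

endsDiffer? : Decidable EndsDiffer
endsDiffer? (t , t′) = ¬? (vertex t ≟V̂ vertex t′) →-dec
  ¬? (List.≡-dec _≟Γ_ (take 21 (block t)) (take 21 (block t′))) ×-dec
  ¬? (List.≡-dec _≟Γ_ (take 21 (reverse (block t))) (take 21 (reverse (block t′))))

ends-differ-checked : Checked endsDiffer? (cartesianProduct tokens tokens)
ends-differ-checked = evaluated refl

no-short-square-checked : Checked (λ (ρ , e) → startsWithShortSquare (ρ ++ e) ≟Bool false) (windows 3)
no-short-square-checked = evaluated refl

-- Keyed by the first 47 letters of a depth-2 window and valued by its suffix part, so
-- `windows-decoded-checked` says that no key belongs to two different suffixes.  Opaque, lest
-- unification unfold it.
opaque
  suffixTable : Trie (List Γ)
  suffixTable = foldr (λ (ρ , e) → insertTrie (take 47 (ρ ++ e)) ρ) empty (windows 2)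

DecodedBy : Trie (List Γ) → List Γ × List Γ → Set
DecodedBy table (ρ , e) = 47 ≤ length (ρ ++ e) → lookupTrie table (take 47 (ρ ++ e)) ≡ just ρ

decodedBy? : ∀ table → Decidable (DecodedBy table)
decodedBy? table (ρ , e) = 47 ≤? length (ρ ++ e) →-dec
  Maybe.≡-dec (List.≡-dec _≟Γ_) (lookupTrie table (take 47 (ρ ++ e))) (just ρ)

opaque
  unfolding suffixTable

  windows-decoded-checked : Checked (decodedBy? suffixTable) (windows 2)
  windows-decoded-checked = evaluated refl

-- Properties of the blocks

block-length : ∀ {t} → IsToken t → 41 ≤ length (block t)
block-length = checked blocks-long-checked ∘ IsToken⇒∈tokens

block-≢[] : ∀ {t} → IsToken t → block t ≢ []
block-≢[] t∈ eq with () ← subst (λ A → 41 ≤ length A) eq (block-length t∈)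

block-too-short : ∀ {t} α {ρ} → IsToken t → block t ≡ α ++ ρ → length α ≤ 20 → length ρ ≤ 20 → ⊥
block-too-short α t∈ t≡ α≤20 ρ≤20 =
  <⇒≱ (block-length t∈) (subst (_≤ 40) (sym (trans (cong length t≡) (length-++ α))) (+-mono-≤ α≤20 ρ≤20))

prefix-block⇒≡ : ∀ {t t′ m} → IsToken t → IsToken t′ → block t′ ≡ block t ++ m → t ≡ t′
prefix-block⇒≡ {t} {m = m} t∈ t′∈ t′≡ =
  checked prefix-free-checked (∈-cartesianProduct⁺ (IsToken⇒∈tokens t∈) (IsToken⇒∈tokens t′∈))
    (trans (cong (take (length (block t))) t′≡) (take-length-++ (block t) m))

blocks-prefix-free : ∀ {t t′ P Q} → IsToken t → IsToken t′ → block t ++ P ≡ block t′ ++ Q → t ≡ t′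
blocks-prefix-free {t} {t′} {P} {Q} t∈ t′∈ eq with ++-≡-++ (block t) P (block t′) Q eq
... | inj₁ (_ , t′≡ , _)    = prefix-block⇒≡ t∈ t′∈ t′≡
... | inj₂ (_ , _ , t≡ , _) = sym (prefix-block⇒≡ t′∈ t∈ t≡)

ends-differ : ∀ {t t′} → IsToken t → IsToken t′ → EndsDiffer (t , t′)
ends-differ t∈ t′∈ = checked ends-differ-checked (∈-cartesianProduct⁺ (IsToken⇒∈tokens t∈) (IsToken⇒∈tokens t′∈))

common-prefix-short : ∀ {t t′} α {β β′} → IsToken t → IsToken t′ → vertex t ≢ vertex t′ →
                      block t ≡ α ++ β → block t′ ≡ α ++ β′ → length α ≤ 20
common-prefix-short α t∈ t′∈ x≢x′ = common-prefix-≤ 20 α (proj₁ (ends-differ t∈ t′∈ x≢x′))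

common-suffix-short : ∀ {t t′} α α′ {ρ} → IsToken t → IsToken t′ → vertex t ≢ vertex t′ →
                      block t ≡ α ++ ρ → block t′ ≡ α′ ++ ρ → length ρ ≤ 20
common-suffix-short α α′ {ρ} t∈ t′∈ x≢x′ t≡ t′≡ =
  subst (_≤ 20) (length-reverse ρ)
    (common-prefix-≤ 20 (reverse ρ) (proj₂ (ends-differ t∈ t′∈ x≢x′))
      (trans (cong reverse t≡) (reverse-++ α ρ)) (trans (cong reverse t′≡) (reverse-++ α′ ρ)))

word-prefix-factor : ∀ {mid ts W} → All IsToken mid → All IsToken ts → word ts ≡ word mid ++ W →
                     ∃[ ts′ ] ts ≡ mid ++ ts′ × word ts′ ≡ W
word-prefix-factor [] _ eq = _ , refl , eq
word-prefix-factor {t ∷ mid} {[]} {W} (t∈ ∷ _) _ eq =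
  ⊥-elim (block-≢[] t∈ (++-conicalˡ (block t) _ (sym (trans eq (++-assoc (block t) (word mid) W)))))
word-prefix-factor {t ∷ mid} {t′ ∷ ts} {W} (t∈ ∷ mid-valid) (t′∈ ∷ valid) eq
  with refl ← blocks-prefix-free t′∈ t∈ (trans eq (++-assoc (block t) (word mid) W))
  with ts′ , refl , ts′≡ ← word-prefix-factor mid-valid valid
                             (++-cancelˡ (block t) _ _ (trans eq (++-assoc (block t) (word mid) W)))
  = ts′ , refl , ts′≡

-- Squares in δ(w)

word-take-drop : ∀ k ts → word ts ≡ word (take k ts) ++ word (drop k ts)
word-take-drop k ts =
  trans (cong word (sym (take++drop≡id k ts))) (concatMap-++ block (take k ts) (drop k ts))

word-take-long : ∀ k {ts} → All IsToken ts → k * 41 ≤ length (word (take k ts)) ⊎ drop k ts ≡ []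
word-take-long zero    _                       = inj₁ z≤n
word-take-long (suc k) []                      = inj₂ refl
word-take-long (suc k) {t ∷ _} (t∈ ∷ valid) with word-take-long k valid
... | inj₂ drop≡[] = inj₂ drop≡[]
... | inj₁ long    = inj₁ (subst (suc k * 41 ≤_) (sym (length-++ (block t))) (+-mono-≤ (block-length t∈) long))

window : ∀ k {x ts} ρ Y {W} → All IsToken ts → IsWalk (x ∷ path ts) → ρ ++ word ts ≡ Y ++ W →
         length Y ≤ length ρ + k * 41 → ∃[ e ] e ∈ continuations k x × ∃[ Z ] ρ ++ e ≡ Y ++ Z
window k {ts = ts} ρ Y {W} valid walk eq Y≤ =
  e , word-take-∈-continuations k valid walk , Y-prefix (word-take-long k valid)
  where
    e : List Γ
    e = word (take k ts)
    split : (ρ ++ e) ++ word (drop k ts) ≡ Y ++ W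
    split = trans (++-assoc ρ e _) (trans (cong (ρ ++_) (sym (word-take-drop k ts))) eq)
    Y-prefix : k * 41 ≤ length e ⊎ drop k ts ≡ [] → ∃[ Z ] ρ ++ e ≡ Y ++ Z
    Y-prefix (inj₁ long) = ++-≡-++-≤ (ρ ++ e) _ Y W split
      (≤-trans Y≤ (subst (length ρ + k * 41 ≤_) (sym (length-++ ρ)) (+-monoʳ-≤ (length ρ) long)))
    Y-prefix (inj₂ drop≡[]) =
      W , trans (sym (++-identityʳ (ρ ++ e))) (trans (cong (λ r → (ρ ++ e) ++ word r) (sym drop≡[])) split)

square-fits : ∀ (y ρ : List Γ) → length y ≤ 46 → length (y ++ y) ≤ length ρ + 3 * 41
square-fits y ρ y≤46 =
  ≤-trans (≤-reflexive (length-++ y)) (≤-trans (+-mono-≤ y≤46 y≤46) (≤-trans (m≤m+n 92 31) (m≤n+m 123 (length ρ))))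

no-short-square : ∀ {t ts} α {ρ y Z} → All IsToken (t ∷ ts) → IsWalk (path (t ∷ ts)) →
                  block t ≡ α ++ ρ → ρ ≢ [] → ρ ++ word ts ≡ y ++ y ++ Z → y ≢ [] → length y ≤ 46 → ⊥
no-short-square α {ρ} {y} {Z} (t∈ ∷ valid) walk t≡ ρ≢[] eq y≢[] y≤46 =
  -- `let` rather than `with`, which would normalise the abstracted arithmetic proof.
  let e , e∈ , Z′ , ρe≡ = window 3 ρ (y ++ y) valid walk (trans eq (sym (++-assoc y y Z))) (square-fits y ρ y≤46)
  in true≢false (begin
       true                                 ≡⟨ sym (startsWithShortSquare-complete y Z′ y≢[] y≤46) ⟩
       startsWithShortSquare (y ++ y ++ Z′) ≡⟨ cong startsWithShortSquare (trans (sym (++-assoc y y Z′)) (sym ρe≡)) ⟩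
       startsWithShortSquare (ρ ++ e)       ≡⟨ checked no-short-square-checked (∈-windows 3 α t∈ t≡ ρ≢[] e∈) ⟩
       false                                ∎)
  where
    open ≡-Reasoning
    true≢false : true ≢ false
    true≢false ()

key-fits : ∀ (Y ρ : List Γ) → length Y ≡ 47 → length Y ≤ length ρ + 2 * 41
key-fits Y ρ Y≡47 = ≤-trans (≤-reflexive Y≡47) (≤-trans (m≤m+n 47 35) (m≤n+m 82 (length ρ)))

suffix-decoded : ∀ {t ts} α {ρ} Y {W} → All IsToken (t ∷ ts) → IsWalk (path (t ∷ ts)) →
                 block t ≡ α ++ ρ → ρ ≢ [] → ρ ++ word ts ≡ Y ++ W → length Y ≡ 47 →
                 lookupTrie suffixTable Y ≡ just ρ
suffix-decoded α {ρ} Y (t∈ ∷ valid) walk t≡ ρ≢[] eq Y≡47 =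
  let e , e∈ , Z , ρe≡ = window 2 ρ Y valid walk eq (key-fits Y ρ Y≡47)
      key≡ = trans (cong (take 47) ρe≡) (subst (λ n → take n (Y ++ Z) ≡ Y) Y≡47 (take-length-++ Y Z))
      long = subst (47 ≤_) (cong length (sym ρe≡)) (subst (_≤ length (Y ++ Z)) Y≡47 (length-++-≤ˡ Y))
  in trans (cong (lookupTrie suffixTable) (sym key≡))
           (checked windows-decoded-checked (∈-windows 2 α t∈ t≡ ρ≢[] e∈) long)

-- A factorisation word ts = X ++ W in which W begins inside the block of `token`.
record Cut (ts : List Token) (X W : List Γ) : Set where
  field
    before   : List Token
    token    : Token
    after    : List Token
    left     : List Γ
    right    : List Γ
    tokens-≡ : ts ≡ before ++ token ∷ after
    block-≡  : block token ≡ left ++ right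
    right≢[] : right ≢ []
    X-≡      : X ≡ word before ++ left
    W-≡      : W ≡ right ++ word after

cut : ∀ ts X {W} → word ts ≡ X ++ W → W ≢ [] → Cut ts X W
cut [] X {W} eq W≢[] = ⊥-elim (W≢[] (++-conicalʳ X W (sym eq)))
cut (t ∷ ts) X {W} eq W≢[] with ++-≡-++ (block t) (word ts) X W eq
... | inj₂ (m , m≢[] , t≡ , W≡) = record
  { before = [] ; token = t ; after = ts ; left = X ; right = m
  ; tokens-≡ = refl ; block-≡ = t≡ ; right≢[] = m≢[] ; X-≡ = refl ; W-≡ = W≡ }
... | inj₁ (m , X≡ , ts≡) = let open Cut (cut ts m ts≡ W≢[]) in record
  { before = t ∷ before ; token = token ; after = after ; left = left ; right = right
  ; tokens-≡ = cong (t ∷_) tokens-≡ ; block-≡ = block-≡ ; right≢[] = right≢[]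
  ; X-≡ = trans X≡ (trans (cong (block t ++_) X-≡) (sym (++-assoc (block t) (word before) left)))
  ; W-≡ = W-≡ }

module _ {ts X W} (κ : Cut ts X W) where
  open Cut κ

  cut-path : path ts ≡ path before ++ path (token ∷ after)
  cut-path = trans (cong path tokens-≡) (map-++ vertex before (token ∷ after))

  cut-valid : All IsToken ts → All IsToken (token ∷ after)
  cut-valid valid = ++⁻ʳ before (subst (All IsToken) tokens-≡ valid)

  cut-walk : IsWalk (path ts) → IsWalk (path (token ∷ after))
  cut-walk walk = IsWalk-++⁻ʳ (path before) (subst IsWalk cut-path walk)

  cut-squareFree : SquareFree (path ts) → SquareFree (path (token ∷ after))
  cut-squareFree sf = SquareFree-++⁻ʳ (path before) (subst SquareFree cut-path sf)

  cut-decoded : ∀ y {W′} → All IsToken ts → IsWalk (path ts) → W ≡ y ++ W′ → 47 ≤ length y →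
                lookupTrie suffixTable (take 47 y) ≡ just right
  cut-decoded y {W′} valid walk W≡ y≥47 =
    suffix-decoded left (take 47 y) (cut-valid valid) (cut-walk walk) block-≡ right≢[]
      (trans (sym W-≡) (trans W≡ y-split)) (trans (length-take 47 y) (m≤n⇒m⊓n≡m y≥47))
    where
      y-split : y ++ W′ ≡ take 47 y ++ drop 47 y ++ W′
      y-split = trans (cong (_++ W′) (sym (take++drop≡id 47 y))) (++-assoc (take 47 y) (drop 47 y) W′)

path-repeat : ∀ t mid t′ ts →
              path (t ∷ mid ++ t′ ∷ mid ++ ts) ≡ vertex t ∷ path mid ++ vertex t′ ∷ path mid ++ path ts
path-repeat t mid t′ ts =
  cong (vertex t ∷_) (trans (map-++ vertex mid _) (cong (λ r → path mid ++ vertex t′ ∷ r) (map-++ vertex mid ts)))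

repeat-prefix-short : ∀ {w} mid {t′ ts} α′ {ρ Z} → All IsToken (t′ ∷ ts) →
                      SquareFree (w ∷ path mid ++ vertex t′ ∷ path mid ++ path ts) →
                      block t′ ≡ α′ ++ ρ → word ts ≡ α′ ++ Z → length α′ ≤ 20
repeat-prefix-short _ {ts = []} α′ _ _ _ ts≡ =
  subst (λ α → length α ≤ 20) (sym (++-conicalˡ α′ _ (sym ts≡))) z≤n
repeat-prefix-short {w} mid {t′} {t″ ∷ ts} α′ {ρ} {Z} (t′∈ ∷ t″∈ ∷ _) sf t′≡ ts≡ with vertex t′ ≟V̂ vertex t″
... | yes x′≡x″ = ⊥-elim (¬SquareFree-M∷ʳx-twice w (path mid) (path ts) x′≡x″ sf)
... | no x′≢x″ with ++-≡-++ (block t″) (word ts) α′ Z ts≡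
...   | inj₂ (_ , _ , t″≡ , _) = common-prefix-short α′ t′∈ t″∈ x′≢x″ t′≡ t″≡
...   | inj₁ (m , α′≡ , _)     = ⊥-elim (<⇒≱ (block-length t″∈) (≤-trans t″-short (m≤m+n 20 20)))
  where
    t″-short : length (block t″) ≤ 20
    t″-short = common-prefix-short (block t″) t″∈ t′∈ (x′≢x″ ∘ sym) (sym (++-identityʳ (block t″)))
                 (trans t′≡ (trans (cong (_++ ρ) α′≡) (++-assoc (block t″) m ρ)))

no-repetition : ∀ {t t′} mid {ts} α α′ {ρ Z} → All IsToken (t ∷ mid ++ t′ ∷ mid ++ ts) →
                SquareFree (vertex t ∷ path mid ++ vertex t′ ∷ path mid ++ path ts) →
                block t ≡ α ++ ρ → block t′ ≡ α′ ++ ρ → word ts ≡ α′ ++ Z → ⊥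
no-repetition {t} {t′} mid {ts} α α′ (t∈ ∷ valid) sf t≡ t′≡ ts≡
  with t′∈ ∷ rest ← ++⁻ʳ mid valid | vertex t ≟V̂ vertex t′
... | yes x≡x′ = ¬SquareFree-x∷M-twice (path mid) (path ts) x≡x′ sf
... | no x≢x′  = block-too-short α′ t′∈ t′≡ (repeat-prefix-short mid α′ (t′∈ ∷ ++⁻ʳ mid rest) sf t′≡ ts≡)
                   (common-suffix-short α α′ t∈ t′∈ x≢x′ t≡ t′≡)

no-repeated-suffix : ∀ {t ts} α {ρ y Z} → All IsToken (t ∷ ts) → SquareFree (path (t ∷ ts)) →
                     block t ≡ α ++ ρ → y ≢ [] → (κ : Cut (t ∷ ts) (α ++ y) (y ++ Z)) → Cut.right κ ≡ ρ → ⊥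
no-repeated-suffix {t} α {ρ} {y} _ _ t≡ y≢[]
  record { before = [] ; left = α′ ; tokens-≡ = refl ; block-≡ = t≡′ ; X-≡ = X≡ } refl =
  y≢[] (++-identityˡ-unique y (++-cancelˡ α _ _ (begin
    α ++ ρ        ≡⟨ sym t≡ ⟩
    block t       ≡⟨ t≡′ ⟩
    α′ ++ ρ       ≡⟨ cong (_++ ρ) (sym X≡) ⟩
    (α ++ y) ++ ρ ≡⟨ ++-assoc α y ρ ⟩
    α ++ y ++ ρ   ∎)))
  where open ≡-Reasoning
no-repeated-suffix {t} α {ρ} {y} {Z} valid@(_ ∷ rest) sf t≡ y≢[]
  record { before = _ ∷ mid ; token = t′ ; after = ts′ ; left = α′ ; tokens-≡ = refl ; block-≡ = t′≡
         ; X-≡ = X≡ ; W-≡ = W≡ } refl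
  with _ ∷ ts′-valid ← ++⁻ʳ mid rest
  with ts″ , refl , ts″≡ ← word-prefix-factor (++⁻ˡ mid rest) ts′-valid
         (++-second-half α ρ (word mid) α′ y Z (word ts′) (trans X≡ (cong (λ B → (B ++ word mid) ++ α′) t≡)) W≡)
  = no-repetition mid α α′ valid (subst SquareFree (path-repeat t mid t′ ts″) sf) t≡ t′≡ ts″≡

no-long-square : ∀ {ts X y Z} → All IsToken ts → IsWalk (path ts) → SquareFree (path ts) →
                 Cut ts X (y ++ y ++ Z) → y ≢ [] → 47 ≤ length y → ⊥
no-long-square {y = y} {Z} valid walk sf κ y≢[] y≥47 =
  no-repeated-suffix left (cut-valid κ valid) (cut-squareFree κ sf) block-≡ y≢[] κ′
    (just-injective (trans (sym (cut-decoded κ′ y (cut-valid κ valid) (cut-walk κ walk) refl y≥47))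
                           (cut-decoded κ y valid walk refl y≥47)))
  where
    open Cut κ
    open ≡-Reasoning
    κ′ : Cut (token ∷ after) (left ++ y) (y ++ Z)
    κ′ = cut (token ∷ after) (left ++ y) (begin
      block token ++ word after     ≡⟨ cong (_++ word after) block-≡ ⟩
      (left ++ right) ++ word after ≡⟨ ++-assoc left right (word after) ⟩
      left ++ right ++ word after   ≡⟨ cong (left ++_) (sym W-≡) ⟩
      left ++ y ++ y ++ Z           ≡⟨ sym (++-assoc left y (y ++ Z)) ⟩
      (left ++ y) ++ y ++ Z         ∎) (y≢[] ∘ ++-conicalˡ y _)

word-squareFree : ∀ {ts} → All IsToken ts → IsWalk (path ts) → SquareFree (path ts) → SquareFree (word ts)
word-squareFree {ts} valid walk sf (X , y , Z , y≢[] , eq)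
  with κ ← cut ts X eq (y≢[] ∘ ++-conicalˡ y _) | length y ≤? 46
... | yes y≤46 = no-short-square (Cut.left κ) (cut-valid κ valid) (cut-walk κ walk) (Cut.block-≡ κ)
                   (Cut.right≢[] κ) (sym (Cut.W-≡ κ)) y≢[] y≤46
... | no y≰46  = no-long-square valid walk sf κ y≢[] (≰⇒> y≰46)

lemma8 : (w : List V̂) → IsWalk w → SquareFree w →
         (u : List Γ) → u ∈ δ w → SquareFree u
lemma8 w walk sf u u∈δw with ts , valid , refl , refl ← δ-factorisation w u∈δw = word-squareFree valid walk sf
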